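{- For every $n\ge 1$, \[\sum_{\sigma\in B_n} q^{\text{flag-major}_N(\sigma)}\,t^{nmaj_N(\sigma)}=\prod_{i=1}^n(1+qt^i)\,[n]_{q^2t}!.\]
   Context: $B_n$ is the group of bijections $\sigma$ of $[-n,n]\setminus\{0\}$ with $\sigma(-a)=-\sigma(a)$, written $\sigma=[\sigma(1),\dots,\sigma(n)]$. $N$ is the natural order $-n<\dots<-1<1<\dots<n$; $maj_N(\sigma)=\sum\{i\in[1,n-1]:\sigma(i)>\sigma(i+1)\}$; $neg(\sigma)=|\{i:\sigma(i)<0\}|$; $nsum(\sigma)=-\sum_{i:\sigma(i)<0}\sigma(i)$; $\text{flag-major}_N(\sigma)=2maj_N(\sigma)+neg(\sigma)$; $nmaj_N(\sigma)=maj_N(\sigma)+nsum(\sigma)$. Notation: $[k]_x=\frac{1-x^k}{1-x}$, $[n]_x!=[1]_x[2]_x\cdots[n]_x$. -}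

module Defs where

open import Data.Nat using (ℕ; zero; suc; _+_; _*_)
open import Data.Integer as ℤ using (ℤ; ∣_∣)
open import Data.Bool using (if_then_else_)
open import Data.Product using (_×_; _,_)
open import Data.List using (List; []; _∷_; map; concatMap; upTo; foldr; length; filter)
open import Data.Nat.ListAction using (sum)
open import Data.Vec using (Vec; toList)
open import Relation.Nullary using (does)
open import Data.List.Relation.Binary.Permutation.Propositional using (_↭_)

-- A bivariate polynomial in q,t with natural-number coefficients is encoded as
-- a finite multiset of exponent pairs (a , b), one entry per monomial q^a t^b
-- (counted with multiplicity).  Two polynomials are equal iff these lists are
-- permutations of each other (_↭_).
Poly : Set
Poly = List (ℕ × ℕ)

one : Poly
one = (0 , 0) ∷ []

_⊗_ : Poly → Poly → Poly
xs ⊗ ys = concatMap (λ { (a , b) → map (λ { (c , d) → (a + c , b + d) }) ys }) xs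

prodP : List Poly → Poly
prodP = foldr _⊗_ one

oneTo : ℕ → List ℕ
oneTo n = map suc (upTo n)

-- [k]_x at x = q^2 t :  1 + x + ... + x^(k-1)
qInt : ℕ → Poly
qInt k = map (λ j → (2 * j , j)) (upTo k)

qFact : ℕ → Poly
qFact n = prodP (map qInt (oneTo n))

negFactor : ℕ → Poly
negFactor n = prodP (map (λ i → (0 , 0) ∷ (1 , i) ∷ []) (oneTo n))

-- Signed permutations σ ∈ B_n, written as the vector [σ(1),…,σ(n)] of
-- integers.
IsSignedPerm : (n : ℕ) → Vec ℤ n → Set
IsSignedPerm n v = map ∣_∣ (toList v) ↭ oneTo n

-- sum of descent positions i (1-based) with w(i) > w(i+1), natural order
majAux : ℕ → List ℤ → ℕ
majAux i [] = 0
majAux i (x ∷ []) = 0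
majAux i (x ∷ y ∷ rest) =
  (if does (y ℤ.<? x) then i else 0) + majAux (suc i) (y ∷ rest)

majN : {n : ℕ} → Vec ℤ n → ℕ
majN v = majAux 1 (toList v)

negEntries : List ℤ → List ℤ
negEntries = filter (λ x → x ℤ.<? ℤ.0ℤ)

neg : {n : ℕ} → Vec ℤ n → ℕ
neg v = length (negEntries (toList v))

nsum : {n : ℕ} → Vec ℤ n → ℕ
nsum v = sum (map ∣_∣ (negEntries (toList v)))

flagMajorN : {n : ℕ} → Vec ℤ n → ℕ
flagMajorN v = 2 * majN v + neg v

nmajN : {n : ℕ} → Vec ℤ n → ℕ
nmajN v = majN v + nsum v

monomial : {n : ℕ} → Vec ℤ n → ℕ × ℕ
monomial v = (flagMajorN v , nmajN v)

{-# OPTIONS --safe #-}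
module Submission where

-- Every signed permutation of [n+1] arises exactly once by inserting n+1 or -(n+1)
-- into a signed permutation w of [n].  A letter larger (or smaller) than every letter
-- of w can be put into the n+1 slots of w so as to raise maj by 0, 1, ..., n, each
-- exactly once (MacMahon's insertion argument), while it raises (neg, nsum) by (0, 0)
-- for n+1 and by (1, n+1) for -(n+1).  So passing from B_n to B_{n+1} multiplies the
-- generating function by (1 + q t^{n+1}) [n+1]_{q²t}.
--
-- The insertion claim is proved by induction from the right end of the word: appending
-- z after a word ending in y adds the (known) position of y exactly when y > z.

open import Defs
open import Data.Bool using (if_then_else_)
open import Data.Nat as ℕ using (ℕ; zero; suc; _+_; _*_; _<_; _≥_; s≤s; s<s⁻¹)
open import Data.Nat.Properties using (+-identityʳ; +-suc; +-comm; +-assoc; <-irrefl)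
open import Data.Nat.Tactic.RingSolver using (solve-∀)
open import Data.Nat.ListAction using (sum)
open import Data.Nat.ListAction.Properties using (sum-↭)
open import Data.Integer as ℤ using (ℤ; ∣_∣; -[1+_]; +<+; -<+; -<-)
import Data.Integer.Properties as ℤₚ
open import Data.Product using (_×_; _,_; proj₁; proj₂; ∃₂)
open import Data.Sum using ([_,_]′)
open import Data.List
  using (List; []; _∷_; [_]; _++_; _∷ʳ_; map; concatMap; filter; length; upTo; applyUpTo)
open import Data.List.Properties
  using ( map-++; map-∘; map-cong; map-cong-local; map-id; map-applyUpTo; applyUpTo-∷ʳ
        ; upTo-∷ʳ; ++-assoc; ++-identityʳ; length-++; length-map; length-upTo
        ; concatMap-++; concatMap-map; map-concatMap; filter-all; filter-accept; filter-reject
        ; ∷-injectiveʳ)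
open import Data.List.Reverse using (Reverse; []; _∶_∶ʳ_; reverseView)
open import Data.List.Relation.Unary.All as All using (All; []; _∷_)
open import Data.List.Relation.Unary.All.Properties using (∷ʳ⁻)
open import Data.List.Relation.Unary.AllPairs using ([]; _∷_)
open import Data.List.Relation.Unary.Any using (here; there)
open import Data.List.Membership.Propositional using (_∈_; _∉_; find; lose)
open import Data.List.Membership.Propositional.Properties
  using (∈-map⁺; ∈-map⁻; ∈-++⁺ˡ; ∈-++⁺ʳ; ∈-++⁻; ∈-concatMap⁺; ∈-concatMap⁻; ∈-∃++; ∈-upTo⁻)
open import Data.List.Membership.Propositional.Properties.WithK using (unique∧set⇒bag)
open import Data.List.Relation.Unary.Unique.Propositional using (Unique)
import Data.List.Relation.Unary.Unique.Propositional.Properties as Unique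
open import Data.List.Relation.Binary.Permutation.Propositional
  using (_↭_; ↭-refl; ↭-sym; ↭-trans; ↭-reflexive; ↭-prep; module PermutationReasoning)
open import Data.List.Relation.Binary.Permutation.Propositional.Properties
  using ( map⁺; ++⁺; ++⁺ˡ; ++⁺ʳ; shift; shifts; drop-∷; ∷↭∷ʳ; ↭-length; filter-↭; ∈-resp-↭
        ; ↭-empty-inv)
open import Data.List.Relation.Binary.BagAndSetEquality using (>>=-cong; ↭⇒∼bag; ∼bag⇒↭)
open import Data.Vec using (Vec; toList; fromList; cast)
open import Data.Vec.Properties using (toList-injective; cast-is-id; toList-cast; toList∘fromList)
open import Function using (_∘_; _⇔_; mk⇔; Equivalence)
open import Relation.Binary.PropositionalEquality
  using (_≡_; _≢_; refl; sym; trans; cong; cong₂; subst; module ≡-Reasoning)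
open import Relation.Nullary using (¬_; does; yes; no)
open import Relation.Nullary.Decidable using (dec-true; dec-false)
open import Relation.Unary using (Decidable)

private variable
  A B : Set

applyUpTo-cong : ∀ (f g : ℕ → A) → (∀ j → f j ≡ g j) → ∀ k → applyUpTo f k ≡ applyUpTo g k
applyUpTo-cong f g f≗g zero = refl
applyUpTo-cong f g f≗g (suc k) =
  cong₂ _∷_ (f≗g 0) (applyUpTo-cong (f ∘ suc) (g ∘ suc) (f≗g ∘ suc) k)

applyUpTo-rotate : ∀ (f g : ℕ → A) {a} k → a ≡ g 0 → (∀ j → f j ≡ g (suc j)) →
                   applyUpTo f k ∷ʳ a ↭ applyUpTo g (suc k)
applyUpTo-rotate f g {a} k a≡g0 f≗g∘suc = ↭-trans (↭-sym (∷↭∷ʳ a (applyUpTo f k)))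
  (↭-reflexive (cong₂ _∷_ a≡g0 (applyUpTo-cong f (g ∘ suc) f≗g∘suc k)))

length-∷ʳ : ∀ (w : List A) y → length (w ∷ʳ y) ≡ suc (length w)
length-∷ʳ w y = trans (length-++ w) (+-comm (length w) 1)

concatMap-∷ : ∀ (f : A → B) (g : A → List B) xs →
              concatMap (λ x → f x ∷ g x) xs ↭ map f xs ++ concatMap g xs
concatMap-∷ f g [] = ↭-refl
concatMap-∷ f g (x ∷ xs) =
  ↭-prep (f x) (↭-trans (++⁺ˡ (g x) (concatMap-∷ f g xs)) (shifts (g x) (map f xs)))

concatMap-cong-∈ : ∀ {f g : A → List B} xs → (∀ {x} → x ∈ xs → f x ↭ g x) →
                   concatMap f xs ↭ concatMap g xs
concatMap-cong-∈ [] _ = ↭-refl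
concatMap-cong-∈ (x ∷ xs) f↭g =
  ++⁺ (f↭g (here refl)) (concatMap-cong-∈ xs (λ x′∈ → f↭g (there x′∈)))

Unique-concatMap⁺ : ∀ {f : A → List B} (g : B → A) {xs} →
                    (∀ {x y} → x ∈ xs → y ∈ f x → g y ≡ x) →
                    (∀ {x} → x ∈ xs → Unique (f x)) → Unique xs → Unique (concatMap f xs)
Unique-concatMap⁺ g {[]} _ _ _ = []
Unique-concatMap⁺ {f = f} g {x ∷ xs} retract unique (x∉xs ∷ uxs) =
  Unique.++⁺ (unique (here refl))
             (Unique-concatMap⁺ g (λ x′∈ → retract (there x′∈)) (λ x′∈ → unique (there x′∈)) uxs)
             disjoint
  where
  disjoint : ∀ {y} → ¬ (y ∈ f x × y ∈ concatMap f xs)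
  disjoint (y∈fx , y∈rest) with find (∈-concatMap⁻ f {xs = xs} y∈rest)
  ... | x′ , x′∈ , y∈fx′ =
    All.lookup x∉xs x′∈ (trans (sym (retract (here refl) y∈fx)) (retract (there x′∈) y∈fx′))

-- Polynomials

infixl 7 _∙_

_∙_ : ℕ × ℕ → ℕ × ℕ → ℕ × ℕ
(a , b) ∙ (c , d) = (a + c , b + d)

∙-identityʳ : ∀ p → p ∙ (0 , 0) ≡ p
∙-identityʳ (a , b) = cong₂ _,_ (+-identityʳ a) (+-identityʳ b)

∙-comm : ∀ p r → p ∙ r ≡ r ∙ p
∙-comm (a , b) (c , d) = cong₂ _,_ (+-comm a c) (+-comm b d)

∙-assoc : ∀ p r s → p ∙ r ∙ s ≡ p ∙ (r ∙ s)
∙-assoc (a , b) (c , d) (e , f) = cong₂ _,_ (+-assoc a c e) (+-assoc b d f)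

x^_ : ℕ → ℕ × ℕ
x^ j = (2 * j , j)

x^-+-∙ : ∀ m j σ s → x^ (m + j) ∙ (σ ∙ s) ≡ (x^ m ∙ s) ∙ (σ ∙ x^ j)
x^-+-∙ m j (a , b) (c , d) = cong₂ _,_ (first m j a c) (second m j b d)
  where
  first : ∀ m j a c → 2 * (m + j) + (a + c) ≡ 2 * m + c + (a + 2 * j)
  first = solve-∀
  second : ∀ m j b d → m + j + (b + d) ≡ m + d + (b + j)
  second = solve-∀

⊗-cong : ∀ {xs xs′ ys ys′} → xs ↭ xs′ → ys ↭ ys′ → xs ⊗ ys ↭ xs′ ⊗ ys′
⊗-cong xs↭ ys↭ = ∼bag⇒↭ (>>=-cong (↭⇒∼bag xs↭) (λ p → ↭⇒∼bag (map⁺ (p ∙_) ys↭)))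

⊗-identityˡ : ∀ xs → one ⊗ xs ≡ xs
⊗-identityˡ xs = trans (++-identityʳ _) (map-id xs)

⊗-identityʳ : ∀ xs → xs ⊗ one ≡ xs
⊗-identityʳ [] = refl
⊗-identityʳ (p ∷ xs) = cong₂ _∷_ (∙-identityʳ p) (⊗-identityʳ xs)

⊗-zeroʳ : ∀ xs → xs ⊗ [] ≡ []
⊗-zeroʳ [] = refl
⊗-zeroʳ (p ∷ xs) = ⊗-zeroʳ xs

map-∙-⊗ : ∀ p ys zs → map (p ∙_) ys ⊗ zs ≡ map (p ∙_) (ys ⊗ zs)
map-∙-⊗ p [] zs = refl
map-∙-⊗ p (r ∷ ys) zs = begin
    map ((p ∙ r) ∙_) zs ++ map (p ∙_) ys ⊗ zs
  ≡⟨ cong₂ _++_ (map-cong (∙-assoc p r) zs) (map-∙-⊗ p ys zs) ⟩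
    map (λ s → p ∙ (r ∙ s)) zs ++ map (p ∙_) (ys ⊗ zs)
  ≡⟨ cong (_++ map (p ∙_) (ys ⊗ zs)) (map-∘ zs) ⟩
    map (p ∙_) (map (r ∙_) zs) ++ map (p ∙_) (ys ⊗ zs)
  ≡⟨ map-++ (p ∙_) (map (r ∙_) zs) (ys ⊗ zs) ⟨
    map (p ∙_) ((r ∷ ys) ⊗ zs)
  ∎
  where open ≡-Reasoning

⊗-assoc : ∀ xs ys zs → (xs ⊗ ys) ⊗ zs ≡ xs ⊗ (ys ⊗ zs)
⊗-assoc [] ys zs = refl
⊗-assoc (p ∷ xs) ys zs = begin
    (map (p ∙_) ys ++ xs ⊗ ys) ⊗ zs        ≡⟨ concatMap-++ _ (map (p ∙_) ys) (xs ⊗ ys) ⟩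
    map (p ∙_) ys ⊗ zs ++ (xs ⊗ ys) ⊗ zs   ≡⟨ cong₂ _++_ (map-∙-⊗ p ys zs) (⊗-assoc xs ys zs) ⟩
    map (p ∙_) (ys ⊗ zs) ++ xs ⊗ (ys ⊗ zs) ∎
  where open ≡-Reasoning

⊗-comm : ∀ xs ys → xs ⊗ ys ↭ ys ⊗ xs
⊗-comm [] ys = ↭-reflexive (sym (⊗-zeroʳ ys))
⊗-comm (p ∷ xs) ys = begin
    map (p ∙_) ys ++ xs ⊗ ys  ↭⟨ ++⁺ˡ (map (p ∙_) ys) (⊗-comm xs ys) ⟩
    map (p ∙_) ys ++ ys ⊗ xs  ≡⟨ cong (_++ ys ⊗ xs) (map-cong (∙-comm p) ys) ⟩
    map (_∙ p) ys ++ ys ⊗ xs  ↭⟨ concatMap-∷ (_∙ p) (λ r → map (r ∙_) xs) ys ⟨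
    ys ⊗ (p ∷ xs)             ∎
  where open PermutationReasoning

⊗-interchange : ∀ a b c d → (a ⊗ b) ⊗ (c ⊗ d) ↭ (a ⊗ c) ⊗ (b ⊗ d)
⊗-interchange a b c d = begin
    (a ⊗ b) ⊗ (c ⊗ d)  ≡⟨ ⊗-assoc a b (c ⊗ d) ⟩
    a ⊗ (b ⊗ (c ⊗ d))  ≡⟨ cong (a ⊗_) (⊗-assoc b c d) ⟨
    a ⊗ ((b ⊗ c) ⊗ d)  ↭⟨ ⊗-cong (↭-refl {x = a}) (⊗-cong (⊗-comm b c) ↭-refl) ⟩
    a ⊗ ((c ⊗ b) ⊗ d)  ≡⟨ cong (a ⊗_) (⊗-assoc c b d) ⟩
    a ⊗ (c ⊗ (b ⊗ d))  ≡⟨ ⊗-assoc a c (b ⊗ d) ⟨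
    (a ⊗ c) ⊗ (b ⊗ d)  ∎
  where open PermutationReasoning

prodP-∷ʳ : ∀ fs f → prodP (fs ∷ʳ f) ≡ prodP fs ⊗ f
prodP-∷ʳ [] f = trans (⊗-identityʳ f) (sym (⊗-identityˡ f))
prodP-∷ʳ (g ∷ fs) f = trans (cong (g ⊗_) (prodP-∷ʳ fs f)) (sym (⊗-assoc g (prodP fs) f))

oneTo-∷ʳ : ∀ n → oneTo (suc n) ≡ oneTo n ∷ʳ suc n
oneTo-∷ʳ n = trans (cong (map suc) (sym (upTo-∷ʳ n))) (map-++ suc (upTo n) [ n ])

prodP-map-oneTo-suc : ∀ (f : ℕ → Poly) n →
                      prodP (map f (oneTo (suc n))) ≡ prodP (map f (oneTo n)) ⊗ f (suc n)
prodP-map-oneTo-suc f n = begin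
  prodP (map f (oneTo (suc n)))           ≡⟨ cong (prodP ∘ map f) (oneTo-∷ʳ n) ⟩
  prodP (map f (oneTo n ∷ʳ suc n))        ≡⟨ cong prodP (map-++ f (oneTo n) [ suc n ]) ⟩
  prodP (map f (oneTo n) ∷ʳ f (suc n))    ≡⟨ prodP-∷ʳ (map f (oneTo n)) (f (suc n)) ⟩
  prodP (map f (oneTo n)) ⊗ f (suc n)     ∎
  where open ≡-Reasoning

insertionFactor : ℕ → Poly
insertionFactor N = ((0 , 0) ∷ (1 , N) ∷ []) ⊗ qInt N

negFactor-⊗-qFact-suc : ∀ n → negFactor (suc n) ⊗ qFact (suc n) ↭
                              (negFactor n ⊗ qFact n) ⊗ insertionFactor (suc n)
negFactor-⊗-qFact-suc n = begin
    negFactor (suc n) ⊗ qFact (suc n)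
  ≡⟨ cong₂ _⊗_ (prodP-map-oneTo-suc (λ i → (0 , 0) ∷ (1 , i) ∷ []) n) (prodP-map-oneTo-suc qInt n) ⟩
    (negFactor n ⊗ ((0 , 0) ∷ (1 , suc n) ∷ [])) ⊗ (qFact n ⊗ qInt (suc n))
  ↭⟨ ⊗-interchange (negFactor n) _ (qFact n) (qInt (suc n)) ⟩
    (negFactor n ⊗ qFact n) ⊗ insertionFactor (suc n)
  ∎
  where open PermutationReasoning

-- Insertions

insertions : A → List A → List (List A)
insertions c [] = [ [ c ] ]
insertions c (a ∷ w) = (c ∷ a ∷ w) ∷ map (a ∷_) (insertions c w)

insertions-∷ʳ : ∀ (c : A) w y →
                insertions c (w ∷ʳ y) ≡ map (_∷ʳ y) (insertions c w) ∷ʳ (w ∷ʳ y ∷ʳ c)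
insertions-∷ʳ c [] y = refl
insertions-∷ʳ c (a ∷ w) y = cong (((c ∷ a ∷ w) ∷ʳ y) ∷_) (begin
    map (a ∷_) (insertions c (w ∷ʳ y))
  ≡⟨ cong (map (a ∷_)) (insertions-∷ʳ c w y) ⟩
    map (a ∷_) (map (_∷ʳ y) (insertions c w) ∷ʳ (w ∷ʳ y ∷ʳ c))
  ≡⟨ map-++ (a ∷_) (map (_∷ʳ y) (insertions c w)) _ ⟩
    map (a ∷_) (map (_∷ʳ y) (insertions c w)) ∷ʳ ((a ∷ w) ∷ʳ y ∷ʳ c)
  ≡⟨ cong (_∷ʳ ((a ∷ w) ∷ʳ y ∷ʳ c))
          (trans (sym (map-∘ (insertions c w))) (map-∘ (insertions c w))) ⟩
    map (_∷ʳ y) (map (a ∷_) (insertions c w)) ∷ʳ ((a ∷ w) ∷ʳ y ∷ʳ c)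
  ∎)
  where open ≡-Reasoning

map-insertions-∷ʳ : ∀ (f : List A → B) c w y →
  map f (insertions c (w ∷ʳ y)) ≡ map (f ∘ (_∷ʳ y)) (insertions c w) ∷ʳ f (w ∷ʳ y ∷ʳ c)
map-insertions-∷ʳ f c w y = trans (cong (map f) (insertions-∷ʳ c w y))
  (trans (map-++ f (map (_∷ʳ y) (insertions c w)) _) (cong (_∷ʳ _) (sym (map-∘ (insertions c w)))))

∈-insertions⁻ : ∀ {c : A} w {l} → l ∈ insertions c w →
                ∃₂ λ xs ys → w ≡ xs ++ ys × l ≡ xs ++ c ∷ ys
∈-insertions⁻ [] (here refl) = [] , [] , refl , refl
∈-insertions⁻ (a ∷ w) (here refl) = [] , a ∷ w , refl , refl
∈-insertions⁻ (a ∷ w) (there l∈) with ∈-map⁻ (a ∷_) l∈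
... | l′ , l′∈ , refl with ∈-insertions⁻ w l′∈
...   | xs , ys , refl , refl = a ∷ xs , ys , refl , refl

∈-insertions⁺ : ∀ (c : A) xs ys → xs ++ c ∷ ys ∈ insertions c (xs ++ ys)
∈-insertions⁺ c [] [] = here refl
∈-insertions⁺ c [] (y ∷ ys) = here refl
∈-insertions⁺ c (x ∷ xs) ys = there (∈-map⁺ (x ∷_) (∈-insertions⁺ c xs ys))

insertions-↭ : ∀ {c : A} {w l} → l ∈ insertions c w → l ↭ c ∷ w
insertions-↭ {c = c} {w} l∈ with ∈-insertions⁻ w l∈
... | xs , ys , refl , refl = shift c xs ys

length-insertions : ∀ {c : A} {w l} → l ∈ insertions c w → length l ≡ suc (length w)
length-insertions l∈ = ↭-length (insertions-↭ l∈)

insertions-unique : ∀ {c : A} {w} → c ∉ w → Unique (insertions c w)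
insertions-unique {w = []} _ = [] ∷ []
insertions-unique {c = c} {a ∷ w} c∉ =
  All.tabulate head≢ ∷ Unique.map⁺ ∷-injectiveʳ (insertions-unique (c∉ ∘ there))
  where
  head≢ : ∀ {l} → l ∈ map (a ∷_) (insertions c w) → c ∷ a ∷ w ≢ l
  head≢ l∈ refl with ∈-map⁻ (a ∷_) l∈
  ... | _ , _ , refl = c∉ (here refl)

filter-insertions : ∀ {P : A → Set} (P? : Decidable P) {c w l} → ¬ P c → All P w →
                    l ∈ insertions c w → filter P? l ≡ w
filter-insertions P? {w = []} ¬Pc [] (here refl) = filter-reject P? ¬Pc
filter-insertions P? {w = a ∷ w} ¬Pc Pw (here refl) =
  trans (filter-reject P? ¬Pc) (filter-all P? Pw)
filter-insertions P? {w = a ∷ w} ¬Pc (Pa ∷ Pw) (there l∈) with ∈-map⁻ (a ∷_) l∈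
... | l′ , l′∈ , refl = trans (filter-accept P? Pa) (cong (a ∷_) (filter-insertions P? ¬Pc Pw l′∈))

-- The major index of insertions

maj : List ℤ → ℕ
maj = majAux 1

majAux-++-∷ : ∀ i u y v → majAux i (u ++ y ∷ v) ≡ majAux i (u ∷ʳ y) + majAux (i + length u) (y ∷ v)
majAux-++-∷ i [] y v = cong (λ k → majAux k (y ∷ v)) (sym (+-identityʳ i))
majAux-++-∷ i (x ∷ []) y v =
  cong₂ _+_ (sym (+-identityʳ _)) (cong (λ k → majAux k (y ∷ v)) (+-comm 1 i))
majAux-++-∷ i (x ∷ x′ ∷ u) y v = begin
    d + majAux (suc i) ((x′ ∷ u) ++ y ∷ v)
  ≡⟨ cong (d +_) (majAux-++-∷ (suc i) (x′ ∷ u) y v) ⟩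
    d + (majAux (suc i) ((x′ ∷ u) ∷ʳ y) + majAux (suc i + length (x′ ∷ u)) (y ∷ v))
  ≡⟨ +-assoc d _ _ ⟨
    d + majAux (suc i) ((x′ ∷ u) ∷ʳ y) + majAux (suc i + length (x′ ∷ u)) (y ∷ v)
  ≡⟨ cong (λ k → d + majAux (suc i) ((x′ ∷ u) ∷ʳ y) + majAux k (y ∷ v)) (+-suc i _) ⟨
    majAux i ((x ∷ x′ ∷ u) ∷ʳ y) + majAux (i + length (x ∷ x′ ∷ u)) (y ∷ v)
  ∎
  where
  open ≡-Reasoning
  d = if does (x′ ℤ.<? x) then i else 0

majAux-descent : ∀ i {y z} → z ℤ.< y → majAux i (y ∷ z ∷ []) ≡ i
majAux-descent i {y} {z} z<y rewrite dec-true (z ℤ.<? y) z<y = +-identityʳ i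

majAux-ascent : ∀ i {y z} → ¬ z ℤ.< y → majAux i (y ∷ z ∷ []) ≡ 0
majAux-ascent i {y} {z} z≮y rewrite dec-false (z ℤ.<? y) z≮y = refl

maj-∷ʳ-∷ʳ : ∀ u y z → maj (u ∷ʳ y ∷ʳ z) ≡ maj (u ∷ʳ y) + majAux (suc (length u)) (y ∷ z ∷ [])
maj-∷ʳ-∷ʳ u y z = trans (cong maj (++-assoc u [ y ] [ z ])) (majAux-++-∷ 1 u y [ z ])

maj-∷ʳ-descent : ∀ u {y z} → z ℤ.< y → maj (u ∷ʳ y ∷ʳ z) ≡ maj (u ∷ʳ y) + suc (length u)
maj-∷ʳ-descent u {y} {z} z<y =
  trans (maj-∷ʳ-∷ʳ u y z) (cong (maj (u ∷ʳ y) +_) (majAux-descent _ z<y))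

maj-∷ʳ-ascent : ∀ u {y z} → ¬ z ℤ.< y → maj (u ∷ʳ y ∷ʳ z) ≡ maj (u ∷ʳ y)
maj-∷ʳ-ascent u {y} {z} z≮y =
  trans (maj-∷ʳ-∷ʳ u y z) (trans (cong (maj (u ∷ʳ y) +_) (majAux-ascent _ z≮y)) (+-identityʳ _))

-- R holds of the letters that c is inserted among; e = 1 when c exceeds them (the new
-- descent is the one after c) and e = 0 when c is below them (it is the one before c).
-- The words l ∷ʳ z for l ∈ insertions c w are the insertions of c into w ∷ʳ z before z.
module MajOfInsertions (c : ℤ) (R : ℤ → Set) (e : ℕ)
  (gain₀ : ∀ {z} → R z → maj (c ∷ z ∷ []) ≡ e)
  (gain : ∀ u {y z} → R y → R z → maj (u ∷ʳ y ∷ʳ c ∷ʳ z) ≡ maj (u ∷ʳ y) + (e + suc (length u)))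
  where

  maj-insertions-∷ʳ : ∀ {w} → Reverse w → ∀ z → All R (w ∷ʳ z) →
    map (λ l → maj (l ∷ʳ z)) (insertions c w) ↭
    applyUpTo (λ j → maj (w ∷ʳ z) + (e + j)) (suc (length w))
  maj-insertions-∷ʳ [] z (Rz ∷ []) = ↭-reflexive (cong [_] (trans (gain₀ Rz) (sym (+-identityʳ e))))
  maj-insertions-∷ʳ (w ∶ r ∶ʳ y) z Rwyz = ↭-trans step
    (↭-reflexive (cong (λ n → applyUpTo (λ j → maj (w ∷ʳ y ∷ʳ z) + (e + j)) (suc n))
                       (sym (length-∷ʳ w y))))
    where
    open PermutationReasoning
    Rwy = proj₁ (∷ʳ⁻ Rwyz)
    X = insertions c w
    M = maj (w ∷ʳ y)
    k = length w

    IH : map (λ l → maj (l ∷ʳ y)) X ↭ applyUpTo (λ j → M + (e + j)) (suc k)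
    IH = maj-insertions-∷ʳ r y Rwy

    expand : map (λ l → maj (l ∷ʳ z)) (insertions c (w ∷ʳ y)) ≡
             map (λ l → maj (l ∷ʳ y ∷ʳ z)) X ∷ʳ (M + (e + suc k))
    expand = trans (map-insertions-∷ʳ _ c w y)
                   (cong (map (λ l → maj (l ∷ʳ y ∷ʳ z)) X ∷ʳ_)
                         (gain w (proj₂ (∷ʳ⁻ Rwy)) (proj₂ (∷ʳ⁻ Rwyz))))

    Goal = map (λ l → maj (l ∷ʳ z)) (insertions c (w ∷ʳ y)) ↭
           applyUpTo (λ j → maj (w ∷ʳ y ∷ʳ z) + (e + j)) (suc (suc k))

    descent : z ℤ.< y → Goal
    -- The shift by the new descent makes the insertion of c between y and z the smallest.
    descent z<y = begin
        map (λ l → maj (l ∷ʳ z)) (insertions c (w ∷ʳ y))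
      ≡⟨ expand ⟩
        map (λ l → maj (l ∷ʳ y ∷ʳ z)) X ∷ʳ (M + (e + suc k))
      ≡⟨ cong (_∷ʳ (M + (e + suc k))) (trans (map-cong-local (All.tabulate shifted)) (map-∘ X)) ⟩
        map (_+ suc (suc k)) (map (λ l → maj (l ∷ʳ y)) X) ∷ʳ (M + (e + suc k))
      ↭⟨ ++⁺ʳ [ M + (e + suc k) ] (map⁺ (_+ suc (suc k)) IH) ⟩
        map (_+ suc (suc k)) (applyUpTo (λ j → M + (e + j)) (suc k)) ∷ʳ (M + (e + suc k))
      ≡⟨ cong (_∷ʳ (M + (e + suc k))) (map-applyUpTo (λ j → M + (e + j)) (_+ suc (suc k)) (suc k)) ⟩
        applyUpTo (λ j → M + (e + j) + suc (suc k)) (suc k) ∷ʳ (M + (e + suc k))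
      ↭⟨ applyUpTo-rotate (λ j → M + (e + j) + suc (suc k))
                          (λ j → maj (w ∷ʳ y ∷ʳ z) + (e + j)) (suc k)
           (trans (first-entry M e k) (cong (_+ (e + 0)) (sym Mz)))
           (λ j → trans (later-entries M e k j) (cong (_+ (e + suc j)) (sym Mz))) ⟩
        applyUpTo (λ j → maj (w ∷ʳ y ∷ʳ z) + (e + j)) (suc (suc k))
      ∎
      where
      shifted : ∀ {l} → l ∈ X → maj (l ∷ʳ y ∷ʳ z) ≡ maj (l ∷ʳ y) + suc (suc k)
      shifted {l} l∈ = trans (maj-∷ʳ-descent l z<y)
                             (cong (λ n → maj (l ∷ʳ y) + suc n) (length-insertions l∈))
      Mz : maj (w ∷ʳ y ∷ʳ z) ≡ M + suc k
      Mz = maj-∷ʳ-descent w z<y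
      first-entry : ∀ M e k → M + (e + suc k) ≡ M + suc k + (e + 0)
      first-entry = solve-∀
      later-entries : ∀ M e k j → M + (e + j) + suc (suc k) ≡ M + suc k + (e + suc j)
      later-entries = solve-∀

    ascent : ¬ z ℤ.< y → Goal
    ascent z≮y = begin
        map (λ l → maj (l ∷ʳ z)) (insertions c (w ∷ʳ y))
      ≡⟨ expand ⟩
        map (λ l → maj (l ∷ʳ y ∷ʳ z)) X ∷ʳ (M + (e + suc k))
      ≡⟨ cong (_∷ʳ (M + (e + suc k))) (map-cong (λ l → maj-∷ʳ-ascent l z≮y) X) ⟩
        map (λ l → maj (l ∷ʳ y)) X ∷ʳ (M + (e + suc k))
      ↭⟨ ++⁺ʳ [ M + (e + suc k) ] IH ⟩
        applyUpTo (λ j → M + (e + j)) (suc k) ∷ʳ (M + (e + suc k))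
      ≡⟨ applyUpTo-∷ʳ (λ j → M + (e + j)) (suc k) ⟩
        applyUpTo (λ j → M + (e + j)) (suc (suc k))
      ≡⟨ applyUpTo-cong _ _ (λ j → cong (_+ (e + j)) (sym (maj-∷ʳ-ascent w z≮y))) (suc (suc k)) ⟩
        applyUpTo (λ j → maj (w ∷ʳ y ∷ʳ z) + (e + j)) (suc (suc k))
      ∎

    step : Goal
    step with z ℤ.<? y
    ... | yes z<y = descent z<y
    ... | no z≮y = ascent z≮y

maj-insertions-max : ∀ {c w} → All (ℤ._< c) w →
                     map maj (insertions c w) ↭ applyUpTo (maj w +_) (suc (length w))
maj-insertions-max {c} {w} w<c with reverseView w
... | [] = ↭-refl
... | w₀ ∶ r ∶ʳ z = begin
    map maj (insertions c (w₀ ∷ʳ z))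
  ≡⟨ map-insertions-∷ʳ maj c w₀ z ⟩
    map (λ l → maj (l ∷ʳ z)) (insertions c w₀) ∷ʳ maj (w₀ ∷ʳ z ∷ʳ c)
  ≡⟨ cong (map (λ l → maj (l ∷ʳ z)) (insertions c w₀) ∷ʳ_) (maj-∷ʳ-ascent w₀ (ℤₚ.<-asym z<c)) ⟩
    map (λ l → maj (l ∷ʳ z)) (insertions c w₀) ∷ʳ M
  ↭⟨ ++⁺ʳ [ M ] (MajOfInsertions.maj-insertions-∷ʳ c (ℤ._< c) 1 gain₀ gain r z w<c) ⟩
    applyUpTo (λ j → M + (1 + j)) (suc (length w₀)) ∷ʳ M
  ↭⟨ applyUpTo-rotate (λ j → M + (1 + j)) (M +_) (suc (length w₀))
                      (sym (+-identityʳ M)) (λ j → refl) ⟩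
    applyUpTo (M +_) (suc (suc (length w₀)))
  ≡⟨ cong (λ n → applyUpTo (M +_) (suc n)) (length-∷ʳ w₀ z) ⟨
    applyUpTo (M +_) (suc (length (w₀ ∷ʳ z)))
  ∎
  where
  open PermutationReasoning
  M = maj (w₀ ∷ʳ z)
  z<c = proj₂ (∷ʳ⁻ w<c)
  gain₀ : ∀ {z} → z ℤ.< c → maj (c ∷ z ∷ []) ≡ 1
  gain₀ = maj-∷ʳ-descent []
  gain : ∀ u {y z} → y ℤ.< c → z ℤ.< c →
         maj (u ∷ʳ y ∷ʳ c ∷ʳ z) ≡ maj (u ∷ʳ y) + (1 + suc (length u))
  gain u {y} y<c z<c = trans (maj-∷ʳ-descent (u ∷ʳ y) z<c)
    (cong₂ _+_ (maj-∷ʳ-ascent u (ℤₚ.<-asym y<c)) (cong suc (length-∷ʳ u y)))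

maj-insertions-min : ∀ {c w} → All (c ℤ.<_) w →
                     map maj (insertions c w) ↭ applyUpTo (maj w +_) (suc (length w))
maj-insertions-min {c} {w} c<w with reverseView w
... | [] = ↭-refl
... | w₀ ∶ r ∶ʳ z = begin
    map maj (insertions c (w₀ ∷ʳ z))
  ≡⟨ map-insertions-∷ʳ maj c w₀ z ⟩
    map (λ l → maj (l ∷ʳ z)) (insertions c w₀) ∷ʳ maj (w₀ ∷ʳ z ∷ʳ c)
  ≡⟨ cong (map (λ l → maj (l ∷ʳ z)) (insertions c w₀) ∷ʳ_) (maj-∷ʳ-descent w₀ (proj₂ (∷ʳ⁻ c<w))) ⟩
    map (λ l → maj (l ∷ʳ z)) (insertions c w₀) ∷ʳ (M + suc (length w₀))
  ↭⟨ ++⁺ʳ [ M + suc (length w₀) ]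
          (MajOfInsertions.maj-insertions-∷ʳ c (c ℤ.<_) 0 gain₀ gain r z c<w) ⟩
    applyUpTo (M +_) (suc (length w₀)) ∷ʳ (M + suc (length w₀))
  ≡⟨ applyUpTo-∷ʳ (M +_) (suc (length w₀)) ⟩
    applyUpTo (M +_) (suc (suc (length w₀)))
  ≡⟨ cong (λ n → applyUpTo (M +_) (suc n)) (length-∷ʳ w₀ z) ⟨
    applyUpTo (M +_) (suc (length (w₀ ∷ʳ z)))
  ∎
  where
  open PermutationReasoning
  M = maj (w₀ ∷ʳ z)
  gain₀ : ∀ {z} → c ℤ.< z → maj (c ∷ z ∷ []) ≡ 0
  gain₀ c<z = maj-∷ʳ-ascent [] (ℤₚ.<-asym c<z)
  gain : ∀ u {y z} → c ℤ.< y → c ℤ.< z →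
         maj (u ∷ʳ y ∷ʳ c ∷ʳ z) ≡ maj (u ∷ʳ y) + (0 + suc (length u))
  gain u c<y c<z = trans (maj-∷ʳ-ascent (u ∷ʳ _) (ℤₚ.<-asym c<z)) (maj-∷ʳ-descent u c<y)

-- Signed permutations

SignedPerm : ℕ → List ℤ → Set
SignedPerm n w = map ∣_∣ w ↭ oneTo n

extend : ℕ → List ℤ → List (List ℤ)
extend n w = insertions (ℤ.+ suc n) w ++ insertions -[1+ n ] w

signedPerms : ℕ → List (List ℤ)
signedPerms zero = [ [] ]
signedPerms (suc n) = concatMap (extend n) (signedPerms n)

oneTo-suc : ∀ n → oneTo (suc n) ↭ suc n ∷ oneTo n
oneTo-suc n = ↭-trans (↭-reflexive (oneTo-∷ʳ n)) (↭-sym (∷↭∷ʳ (suc n) (oneTo n)))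

∈-oneTo⁻ : ∀ {n m} → m ∈ oneTo n → m < suc n
∈-oneTo⁻ m∈ with ∈-map⁻ suc m∈
... | _ , k∈ , refl = s≤s (∈-upTo⁻ k∈)

SignedPerm-length : ∀ {n w} → SignedPerm n w → length w ≡ n
SignedPerm-length {n} {w} σ = begin
  length w                   ≡⟨ length-map ∣_∣ w ⟨
  length (map ∣_∣ w)         ≡⟨ ↭-length σ ⟩
  length (map suc (upTo n))  ≡⟨ length-map suc (upTo n) ⟩
  length (upTo n)            ≡⟨ length-upTo n ⟩
  n                          ∎
  where open ≡-Reasoning

SignedPerm-bounded : ∀ {n w} → SignedPerm n w → All (λ x → ∣ x ∣ < suc n) w
SignedPerm-bounded σ = All.tabulate (λ x∈ → ∈-oneTo⁻ (∈-resp-↭ σ (∈-map⁺ ∣_∣ x∈)))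

∣i∣<1+n⇒i<+[1+n] : ∀ {n} i → ∣ i ∣ < suc n → i ℤ.< ℤ.+ suc n
∣i∣<1+n⇒i<+[1+n] (ℤ.+ _) m<1+n = +<+ m<1+n
∣i∣<1+n⇒i<+[1+n] -[1+ _ ] _ = -<+

∣i∣<1+n⇒-[1+n]<i : ∀ {n} i → ∣ i ∣ < suc n → -[1+ n ] ℤ.< i
∣i∣<1+n⇒-[1+n]<i (ℤ.+ _) _ = -<+
∣i∣<1+n⇒-[1+n]<i -[1+ _ ] 1+m<1+n = -<- (s<s⁻¹ 1+m<1+n)

SignedPerm⇒All<+[1+n] : ∀ {n w} → SignedPerm n w → All (ℤ._< ℤ.+ suc n) w
SignedPerm⇒All<+[1+n] σ = All.map (λ {x} → ∣i∣<1+n⇒i<+[1+n] x) (SignedPerm-bounded σ)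

SignedPerm⇒All>-[1+n] : ∀ {n w} → SignedPerm n w → All (-[1+ n ] ℤ.<_) w
SignedPerm⇒All>-[1+n] σ = All.map (λ {x} → ∣i∣<1+n⇒-[1+n]<i x) (SignedPerm-bounded σ)

SignedPerm-insert : ∀ {n c w l} → ∣ c ∣ ≡ suc n → SignedPerm n w → l ∈ insertions c w →
                    SignedPerm (suc n) l
SignedPerm-insert {n} {c} {w} {l} ∣c∣ σ l∈ = begin
  map ∣_∣ l            ↭⟨ map⁺ ∣_∣ (insertions-↭ l∈) ⟩
  ∣ c ∣ ∷ map ∣_∣ w    ≡⟨ cong (_∷ map ∣_∣ w) ∣c∣ ⟩
  suc n ∷ map ∣_∣ w    ↭⟨ ↭-prep (suc n) σ ⟩
  suc n ∷ oneTo n      ↭⟨ oneTo-suc n ⟨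
  oneTo (suc n)        ∎
  where open PermutationReasoning

SignedPerm-remove : ∀ {n} xs c ys → ∣ c ∣ ≡ suc n → SignedPerm (suc n) (xs ++ c ∷ ys) →
                    SignedPerm n (xs ++ ys)
SignedPerm-remove {n} xs c ys ∣c∣ σ = drop-∷ (begin
  suc n ∷ map ∣_∣ (xs ++ ys)          ≡⟨ cong₂ _∷_ (sym ∣c∣) (map-++ ∣_∣ xs ys) ⟩
  ∣ c ∣ ∷ map ∣_∣ xs ++ map ∣_∣ ys    ↭⟨ shift ∣ c ∣ (map ∣_∣ xs) (map ∣_∣ ys) ⟨
  map ∣_∣ xs ++ ∣ c ∣ ∷ map ∣_∣ ys    ≡⟨ map-++ ∣_∣ xs (c ∷ ys) ⟨
  map ∣_∣ (xs ++ c ∷ ys)              ↭⟨ σ ⟩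
  oneTo (suc n)                       ↭⟨ oneTo-suc n ⟩
  suc n ∷ oneTo n                     ∎)
  where open PermutationReasoning

extend-sound : ∀ {n w l} → SignedPerm n w → l ∈ extend n w → SignedPerm (suc n) l
extend-sound σ l∈ = [ SignedPerm-insert refl σ , SignedPerm-insert refl σ ]′ (∈-++⁻ _ l∈)

signedPerms-sound : ∀ n {l} → l ∈ signedPerms n → SignedPerm n l
signedPerms-sound zero (here refl) = ↭-refl
signedPerms-sound (suc n) l∈ with find (∈-concatMap⁻ (extend n) {xs = signedPerms n} l∈)
... | w , w∈ , l∈ext = extend-sound (signedPerms-sound n w∈) l∈ext

signedPerms-complete : ∀ n {l} → SignedPerm n l → l ∈ signedPerms n
signedPerms-complete zero {[]} _ = here refl
signedPerms-complete zero {x ∷ l} σ with ↭-empty-inv σ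
... | ()
signedPerms-complete (suc n) {l} σ
  with ∈-map⁻ ∣_∣ (∈-resp-↭ (↭-sym σ) (∈-resp-↭ (↭-sym (oneTo-suc n)) (here refl)))
... | c , c∈ , 1+n≡∣c∣ with ∈-∃++ c∈
...   | xs , ys , refl =
  ∈-concatMap⁺ (extend n) {xs = signedPerms n} (lose w∈ (∈-extend c (sym 1+n≡∣c∣)))
  where
  w∈ : xs ++ ys ∈ signedPerms n
  w∈ = signedPerms-complete n (SignedPerm-remove xs c ys (sym 1+n≡∣c∣) σ)
  ∈-extend : ∀ c → ∣ c ∣ ≡ suc n → xs ++ c ∷ ys ∈ extend n (xs ++ ys)
  ∈-extend (ℤ.+ _) refl = ∈-++⁺ˡ (∈-insertions⁺ _ xs ys)
  ∈-extend -[1+ _ ] refl = ∈-++⁺ʳ _ (∈-insertions⁺ _ xs ys)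

extend-unique : ∀ {n w} → SignedPerm n w → Unique (extend n w)
extend-unique {n} {w} σ = Unique.++⁺ (insertions-unique max∉) (insertions-unique min∉) disjoint
  where
  max∉ : ℤ.+ suc n ∉ w
  max∉ N∈ = ℤₚ.<-irrefl refl (All.lookup (SignedPerm⇒All<+[1+n] σ) N∈)
  min∉ : -[1+ n ] ∉ w
  min∉ N∈ = ℤₚ.<-irrefl refl (All.lookup (SignedPerm⇒All>-[1+n] σ) N∈)
  disjoint : ∀ {l} → ¬ (l ∈ insertions (ℤ.+ suc n) w × l ∈ insertions -[1+ n ] w)
  disjoint (l∈₊ , l∈₋)
    with ∈-resp-↭ (insertions-↭ l∈₋) (∈-resp-↭ (↭-sym (insertions-↭ l∈₊)) (here refl))
  ... | there N∈ = max∉ N∈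

-- Deleting the letters of absolute value n+1 undoes extend n.
signedPerms-unique : ∀ n → Unique (signedPerms n)
signedPerms-unique zero = [] ∷ []
signedPerms-unique (suc n) = Unique-concatMap⁺ (filter below) retract
  (λ w∈ → extend-unique (signedPerms-sound n w∈)) (signedPerms-unique n)
  where
  below : Decidable (λ x → ∣ x ∣ < suc n)
  below x = ∣ x ∣ ℕ.<? suc n
  retract : ∀ {w l} → w ∈ signedPerms n → l ∈ extend n w → filter below l ≡ w
  retract w∈ l∈ = [ filter-insertions below (<-irrefl refl) bounded
                  , filter-insertions below (<-irrefl refl) bounded ]′ (∈-++⁻ _ l∈)
    where bounded = SignedPerm-bounded (signedPerms-sound n w∈)

-- The generating function

signStats : List ℤ → ℕ × ℕ
signStats l = (length (negEntries l) , sum (map ∣_∣ (negEntries l)))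

signStats-↭ : ∀ {l l′} → l ↭ l′ → signStats l ≡ signStats l′
signStats-↭ l↭l′ = cong₂ _,_ (↭-length neg↭) (sum-↭ (map⁺ ∣_∣ neg↭))
  where neg↭ = filter-↭ (ℤ._<? ℤ.0ℤ) l↭l′

mono : List ℤ → ℕ × ℕ
mono l = x^ (maj l) ∙ signStats l

map-qInt : ∀ (f : ℕ × ℕ → A) N → map f (qInt N) ≡ applyUpTo (f ∘ x^_) N
map-qInt f N = trans (sym (map-∘ (upTo N))) (map-applyUpTo (λ j → j) (f ∘ x^_) N)

mono-insertions : ∀ {c w σ N} →
  map maj (insertions c w) ↭ applyUpTo (maj w +_) N →
  signStats (c ∷ w) ≡ σ ∙ signStats w →
  map mono (insertions c w) ↭ map (mono w ∙_) (map (σ ∙_) (qInt N))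
mono-insertions {c} {w} {σ} {N} majs signs = begin
    map mono (insertions c w)
  ≡⟨ map-cong-local (All.tabulate same-signs) ⟩
    map (λ l → x^ (maj l) ∙ S) (insertions c w)
  ≡⟨ map-∘ (insertions c w) ⟩
    map (λ m → x^ m ∙ S) (map maj (insertions c w))
  ↭⟨ map⁺ (λ m → x^ m ∙ S) majs ⟩
    map (λ m → x^ m ∙ S) (applyUpTo (maj w +_) N)
  ≡⟨ map-applyUpTo (maj w +_) (λ m → x^ m ∙ S) N ⟩
    applyUpTo (λ j → x^ (maj w + j) ∙ S) N
  ≡⟨ applyUpTo-cong _ (λ j → mono w ∙ (σ ∙ x^ j)) shift-monomial N ⟩
    applyUpTo (λ j → mono w ∙ (σ ∙ x^ j)) N
  ≡⟨ trans (sym (map-∘ (qInt N))) (map-qInt (λ p → mono w ∙ (σ ∙ p)) N) ⟨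
    map (mono w ∙_) (map (σ ∙_) (qInt N))
  ∎
  where
  open PermutationReasoning
  S = signStats (c ∷ w)
  same-signs : ∀ {l} → l ∈ insertions c w → mono l ≡ x^ (maj l) ∙ S
  same-signs {l} l∈ = cong (x^ (maj l) ∙_) (signStats-↭ (insertions-↭ l∈))
  shift-monomial : ∀ j → x^ (maj w + j) ∙ S ≡ mono w ∙ (σ ∙ x^ j)
  shift-monomial j = trans (cong (x^ (maj w + j) ∙_) signs) (x^-+-∙ (maj w) j σ (signStats w))

extend-mono : ∀ {n w} → SignedPerm n w →
              map mono (extend n w) ↭ map (mono w ∙_) (insertionFactor (suc n))
extend-mono {n} {w} σ = begin
    map mono (extend n w)
  ≡⟨ map-++ mono (insertions (ℤ.+ suc n) w) _ ⟩
    map mono (insertions (ℤ.+ suc n) w) ++ map mono (insertions -[1+ n ] w)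
  ↭⟨ ++⁺ (mono-insertions (counted (maj-insertions-max (SignedPerm⇒All<+[1+n] σ))) refl)
         (↭-trans (mono-insertions (counted (maj-insertions-min (SignedPerm⇒All>-[1+n] σ))) refl)
                  (↭-reflexive (cong (map (mono w ∙_)) (sym (++-identityʳ _))))) ⟩
    map (mono w ∙_) (map ((0 , 0) ∙_) (qInt (suc n))) ++
    map (mono w ∙_) (map ((1 , suc n) ∙_) (qInt (suc n)) ++ [])
  ≡⟨ map-++ (mono w ∙_) (map ((0 , 0) ∙_) (qInt (suc n))) _ ⟨
    map (mono w ∙_) (insertionFactor (suc n))
  ∎
  where
  open PermutationReasoning
  counted : ∀ {c} → map maj (insertions c w) ↭ applyUpTo (maj w +_) (suc (length w)) →
            map maj (insertions c w) ↭ applyUpTo (maj w +_) (suc n)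
  counted majs = ↭-trans majs
    (↭-reflexive (cong (λ m → applyUpTo (maj w +_) (suc m)) (SignedPerm-length σ)))

signedPerms-mono : ∀ n → map mono (signedPerms n) ↭ negFactor n ⊗ qFact n
signedPerms-mono zero = ↭-refl
signedPerms-mono (suc n) = begin
    map mono (concatMap (extend n) (signedPerms n))
  ≡⟨ map-concatMap mono (extend n) (signedPerms n) ⟩
    concatMap (map mono ∘ extend n) (signedPerms n)
  ↭⟨ concatMap-cong-∈ (signedPerms n) (λ w∈ → extend-mono (signedPerms-sound n w∈)) ⟩
    concatMap (λ w → map (mono w ∙_) (insertionFactor (suc n))) (signedPerms n)
  ≡⟨ concatMap-map (λ p → map (p ∙_) (insertionFactor (suc n))) mono (signedPerms n) ⟨
    map mono (signedPerms n) ⊗ insertionFactor (suc n)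
  ↭⟨ ⊗-cong (signedPerms-mono n) ↭-refl ⟩
    (negFactor n ⊗ qFact n) ⊗ insertionFactor (suc n)
  ↭⟨ negFactor-⊗-qFact-suc n ⟨
    negFactor (suc n) ⊗ qFact (suc n)
  ∎
  where open PermutationReasoning

toList-enumeration : ∀ {n} (Bn : List (Vec ℤ n)) → Unique Bn →
                     (∀ v → (v ∈ Bn) ⇔ IsSignedPerm n v) → map toList Bn ↭ signedPerms n
toList-enumeration {n} Bn unique-Bn Bn⇔ = ∼bag⇒↭ (unique∧set⇒bag
  (Unique.map⁺ toList-inj unique-Bn) (signedPerms-unique n) (mk⇔ to from))
  where
  toList-inj : ∀ {v v′ : Vec ℤ n} → toList v ≡ toList v′ → v ≡ v′
  toList-inj {v} {v′} eq = trans (sym (cast-is-id refl v)) (toList-injective refl v v′ eq)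
  to : ∀ {l} → l ∈ map toList Bn → l ∈ signedPerms n
  to l∈ with ∈-map⁻ toList l∈
  ... | v , v∈ , refl = signedPerms-complete n (Equivalence.to (Bn⇔ v) v∈)
  from : ∀ {l} → l ∈ signedPerms n → l ∈ map toList Bn
  from {l} l∈ = subst (_∈ map toList Bn) toList-v
    (∈-map⁺ toList (Equivalence.from (Bn⇔ v) (subst (SignedPerm n) (sym toList-v) σ)))
    where
    σ = signedPerms-sound n l∈
    v = cast (SignedPerm-length σ) (fromList l)
    toList-v : toList v ≡ l
    toList-v = trans (toList-cast _ (fromList l)) (toList∘fromList l)

mainTheorem4 : (n : ℕ) → n ≥ 1 →
    (Bn : List (Vec ℤ n)) → Unique Bn → (∀ v → (v ∈ Bn) ⇔ IsSignedPerm n v) →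
    map monomial Bn ↭ (negFactor n ⊗ qFact n)
mainTheorem4 n _ Bn unique-Bn Bn⇔ = begin
  map monomial Bn           ≡⟨ map-∘ Bn ⟩
  map mono (map toList Bn)  ↭⟨ map⁺ mono (toList-enumeration Bn unique-Bn Bn⇔) ⟩
  map mono (signedPerms n)  ↭⟨ signedPerms-mono n ⟩
  negFactor n ⊗ qFact n     ∎
  where open PermutationReasoning
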